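{- Let $h,m,n,a$ be positive integers and $\varepsilon\in\{ -1,1\}$. Then \[ \frac{\gcd(2,n)}{n(n+1)(n+2)}\sum_{k=1}^{n}\varepsilon^{k}k^a(k+1)^a(2k+1)D_{k}^{(h)}(x)^{m}\in\mathbb{Z}[x]. \]
   Context: For $h\in\mathbb{Z}^{+}$ and $n\in\mathbb{N}$, the generalized Delannoy (Schmidt) polynomial is $D_n^{(h)}(x)=\sum_{k=0}^{n}\binom{n+k}{2k}^{h}\binom{2k}{k}^{h}x^{k}=\sum_{k=0}^{n}\binom{n}{k}^h\binom{n+k}{k}^h x^k$. Here $\gcd(2,n)$ denotes the greatest common divisor of $2$ and $n$. -}

module Defs where

open import Data.Nat as ℕ using (ℕ; zero; suc)
open import Data.Nat.Combinatorics using (_C_)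
open import Data.Integer as ℤ using (ℤ; +_)
open import Data.List using (List; []; _∷_; map; upTo; foldr)

-- Polynomials in ℤ[x], represented by coefficient lists (constant term first).
Poly : Set
Poly = List ℤ

coeff : Poly → ℕ → ℤ
coeff []       _       = + 0
coeff (c ∷ p)  zero    = c
coeff (c ∷ p)  (suc i) = coeff p i

const : ℤ → Poly
const c = c ∷ []

_⊕_ : Poly → Poly → Poly
[]      ⊕ q       = q
(c ∷ p) ⊕ []      = c ∷ p
(c ∷ p) ⊕ (d ∷ q) = (c ℤ.+ d) ∷ (p ⊕ q)

_·_ : ℤ → Poly → Poly
c · p = map (c ℤ.*_) p

_⊗_ : Poly → Poly → Poly
[]      ⊗ q = []
(c ∷ p) ⊗ q = (c · q) ⊕ (+ 0 ∷ (p ⊗ q))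

_^ᵖ_ : Poly → ℕ → Poly
p ^ᵖ zero  = const (+ 1)
p ^ᵖ suc m = p ⊗ (p ^ᵖ m)

D : ℕ → ℕ → Poly
D h n = map (λ k → + (((n C k) ℕ.^ h) ℕ.* (((n ℕ.+ k) C k) ℕ.^ h))) (upTo (suc n))

sumFrom1 : ℕ → (ℕ → Poly) → Poly
sumFrom1 zero    f = []
sumFrom1 (suc n) f = sumFrom1 n f ⊕ f (suc n)

summand : ℕ → ℕ → ℕ → ℤ → ℕ → Poly
summand h m a ε k =
  ((ε ℤ.^ k) ℤ.* (+ ((k ℕ.^ a) ℕ.* ((suc k) ℕ.^ a) ℕ.* (2 ℕ.* k ℕ.+ 1))))
    · (D h k ^ᵖ m)

S : ℕ → ℕ → ℕ → ℕ → ℤ → Poly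
S h m n a ε = sumFrom1 n (summand h m a ε)

-- Write B l k = C(k, l) C(k + l, l), so that B 1 k = k (k + 1) and the coefficient of x^l in
-- D_k^{(h)}(x) is (B l k)^h. The recurrence (l + 1)² B (l + 1) k = (k (k + 1) − l (l + 1)) B l k
-- gives the linearisation B i k · B j k = Σ_l C(l, i) C(l, j) C(i + j, l) B l k, so the integer
-- combinations of the B l (as functions of k) form a ring, which contains every coefficient of
-- k^a (k + 1)^a D_k^{(h)}(x)^m. For ε = ±1 the sum Σ_{k<n} ε^k (2k + 1) B l k telescopes to n times
-- an integer, hence n divides Σ_{k<n} ε^k (2k + 1) f k for every f in that ring. As the summand
-- of the theorem is moreover divisible by k (k + 1), the whole sum is divisible by n, n + 1 and
-- n + 2, and lcm(n, n + 1, n + 2) = n (n + 1) (n + 2) / gcd(2, n).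

{-# OPTIONS --safe #-}
module Submission where

open import Defs
open import Data.Nat as ℕ using (ℕ; _≤_)
open import Data.Nat.GCD using (gcd)
open import Data.Integer as ℤ using (ℤ; +_; -_)
open import Data.Integer.Divisibility using (_∣_)
open import Data.Sum using (_⊎_)
open import Relation.Binary.PropositionalEquality using (_≡_)

open import Data.Nat using (zero; suc; s≤s; _<_; _∸_)
import Data.Nat.Properties as ℕP
import Data.Nat.Tactic.RingSolver as ℕSolver
open import Data.Nat.Combinatorics using (_C_; nCk+nC[k+1]≡[n+1]C[k+1]; nC1≡n; nCn≡1; k>n⇒nCk≡0)
open import Data.Integer using (0ℤ; 1ℤ; -1ℤ; _+_; _*_; _-_; _^_)
import Data.Integer.Properties as ℤP
open import Data.Integer.Tactic.RingSolver using (solve-∀)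
open import Data.Integer.Divisibility.Signed as Signed
  using (∣-refl; ∣-trans; ∣m∣n⇒∣m+n; ∣m+n∣n⇒∣m; ∣n⇒∣m*n; ∣m⇒∣m*n; ∣⇒∣ᵤ)
  renaming (_∣_ to _∣ₛ_)
open import Data.Sum using (inj₁; inj₂)
open import Data.Product using (_×_; _,_; proj₁; proj₂)
import Data.Nat.Divisibility as ℕ∣
open ℕ∣ using () renaming (_∣_ to _∣ℕ_)
open import Data.Nat.GCD using (gcd[m,n]∣m; gcd[m,n]∣n; gcd-greatest)
open import Data.Nat.LCM using (lcm-least; gcd*lcm)
open import Data.List using ([]; _∷_; map; applyUpTo)
open import Function using (id)
open import Relation.Nullary using (yes; no)
open import Relation.Binary.PropositionalEquality
  using (refl; sym; trans; cong; cong₂; subst; subst₂; _≗_; module ≡-Reasoning)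

open ≡-Reasoning

-- Binomial coefficients

C-absorption : ∀ n k → suc k ℕ.* (suc n C suc k) ≡ suc n ℕ.* (n C k)
C-absorption zero    zero    = refl
C-absorption zero    (suc k) = ℕP.*-zeroʳ (suc (suc k))
C-absorption (suc n) zero    =
  trans (ℕP.*-identityˡ _) (trans (nC1≡n (suc (suc n))) (sym (ℕP.*-identityʳ (suc (suc n)))))
C-absorption (suc n) (suc k) = begin
    (2 ℕ.+ k) ℕ.* (suc (suc n) C suc (suc k))
  ≡⟨ cong ((2 ℕ.+ k) ℕ.*_) (sym (nCk+nC[k+1]≡[n+1]C[k+1] (suc n) (suc k))) ⟩
    (2 ℕ.+ k) ℕ.* (x ℕ.+ y)
  ≡⟨ split k x y ⟩
    (1 ℕ.+ k) ℕ.* x ℕ.+ x ℕ.+ (2 ℕ.+ k) ℕ.* y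
  ≡⟨ cong₂ (λ u v → u ℕ.+ x ℕ.+ v) (C-absorption n k) (C-absorption n (suc k)) ⟩
    (1 ℕ.+ n) ℕ.* (n C k) ℕ.+ x ℕ.+ (1 ℕ.+ n) ℕ.* (n C suc k)
  ≡⟨ regroup n (n C k) (n C suc k) x ⟩
    (1 ℕ.+ n) ℕ.* ((n C k) ℕ.+ (n C suc k)) ℕ.+ x
  ≡⟨ cong (λ z → (1 ℕ.+ n) ℕ.* z ℕ.+ x) (nCk+nC[k+1]≡[n+1]C[k+1] n k) ⟩
    (1 ℕ.+ n) ℕ.* x ℕ.+ x
  ≡⟨ ℕP.+-comm ((1 ℕ.+ n) ℕ.* x) x ⟩
    (2 ℕ.+ n) ℕ.* x
  ∎
  where
  x = suc n C suc k
  y = suc n C suc (suc k)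
  split : ∀ k x y → (2 ℕ.+ k) ℕ.* (x ℕ.+ y) ≡ (1 ℕ.+ k) ℕ.* x ℕ.+ x ℕ.+ (2 ℕ.+ k) ℕ.* y
  split = ℕSolver.solve-∀
  regroup : ∀ n a b x →
    (1 ℕ.+ n) ℕ.* a ℕ.+ x ℕ.+ (1 ℕ.+ n) ℕ.* b ≡ (1 ℕ.+ n) ℕ.* (a ℕ.+ b) ℕ.+ x
  regroup = ℕSolver.solve-∀

binom : ℕ → ℕ → ℤ
binom n k = + (n C k)

binom-pascal : ∀ n k → binom n k + binom n (suc k) ≡ binom (suc n) (suc k)
binom-pascal n k = trans (sym (ℤP.pos-+ (n C k) _)) (cong +_ (nCk+nC[k+1]≡[n+1]C[k+1] n k))

binom-absorption : ∀ n k → + suc k * binom (suc n) (suc k) ≡ + suc n * binom n k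
binom-absorption n k =
  trans (sym (ℤP.pos-* (suc k) _)) (trans (cong +_ (C-absorption n k)) (ℤP.pos-* (suc n) _))

binom-vanishes : ∀ {n k} → n < k → binom n k ≡ 0ℤ
binom-vanishes n<k = cong +_ (k>n⇒nCk≡0 n<k)

binom-diagonal : ∀ n → binom n n ≡ 1ℤ
binom-diagonal n = cong +_ (nCn≡1 n)

-- (k + 1) C(n, k + 1) = (n - k) C(n, k), and (n + 1 - k) C(n + 1, k) = (n + 1) C(n, k),
-- with the subtracted terms moved to the left.
binom-row-step : ∀ n k → + suc k * binom n (suc k) + + k * binom n k ≡ + n * binom n k
binom-row-step n k = begin
    + suc k * y + + k * x
  ≡⟨ expand (+ k) x y ⟩
    + suc k * (x + y) - x
  ≡⟨ cong (λ z → + suc k * z - x) (binom-pascal n k) ⟩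
    + suc k * binom (suc n) (suc k) - x
  ≡⟨ cong (_- x) (binom-absorption n k) ⟩
    + suc n * x - x
  ≡⟨ cancel (+ n) x ⟩
    + n * x
  ∎
  where
  x = binom n k
  y = binom n (suc k)
  expand : ∀ k x y → (+ 1 + k) * y + k * x ≡ (+ 1 + k) * (x + y) - x
  expand = solve-∀
  cancel : ∀ n x → (+ 1 + n) * x - x ≡ n * x
  cancel = solve-∀

binom-column-step : ∀ n k → + suc n * binom n k + + k * binom (suc n) k ≡ + suc n * binom (suc n) k
binom-column-step n k =
  trans (cong (_+ + k * binom (suc n) k) (sym (binom-absorption n k))) (binom-row-step (suc n) k)

binom-column-step′ : ∀ l n → + suc n * binom (l ℕ.+ suc n) l ≡ + suc (l ℕ.+ n) * binom (l ℕ.+ n) l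
binom-column-step′ l n = begin
    + suc n * binom (l ℕ.+ suc n) l
  ≡⟨ cong (λ m → + suc n * binom m l) (ℕP.+-suc l n) ⟩
    + suc n * y
  ≡⟨ expand (+ l) (+ n) y ⟩
    + suc (l ℕ.+ n) * y - + l * y
  ≡⟨ cong (_- + l * y) (sym (binom-column-step (l ℕ.+ n) l)) ⟩
    + suc (l ℕ.+ n) * x + + l * y - + l * y
  ≡⟨ cancel (+ suc (l ℕ.+ n) * x) (+ l * y) ⟩
    + suc (l ℕ.+ n) * x
  ∎
  where
  x = binom (l ℕ.+ n) l
  y = binom (suc (l ℕ.+ n)) l
  expand : ∀ l n y → (+ 1 + n) * y ≡ (+ 1 + l + n) * y - l * y
  expand = solve-∀
  cancel : ∀ a b → a + b - b ≡ a
  cancel = solve-∀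

infix 5 ∑<
∑< : ℕ → (ℕ → ℤ) → ℤ
∑< zero    f = 0ℤ
∑< (suc n) f = ∑< n f + f n

syntax ∑< n (λ k → e) = ∑[ k < n ] e

∑-cong : ∀ n {f g} → f ≗ g → ∑< n f ≡ ∑< n g
∑-cong zero    f≗g = refl
∑-cong (suc n) f≗g = cong₂ _+_ (∑-cong n f≗g) (f≗g n)

∑-+ : ∀ n f g → ∑[ k < n ] (f k + g k) ≡ ∑< n f + ∑< n g
∑-+ zero    f g = refl
∑-+ (suc n) f g = trans (cong (_+ (f n + g n)) (∑-+ n f g)) (interchange (∑< n f) (∑< n g) (f n) (g n))
  where
  interchange : ∀ a b c d → a + b + (c + d) ≡ a + c + (b + d)
  interchange = solve-∀

∑-*ˡ : ∀ n c f → ∑[ k < n ] (c * f k) ≡ c * ∑< n f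
∑-*ˡ zero    c f = sym (ℤP.*-zeroʳ c)
∑-*ˡ (suc n) c f = trans (cong (_+ c * f n) (∑-*ˡ n c f)) (sym (ℤP.*-distribˡ-+ c _ _))

∑-vanishes : ∀ n f → (∀ k → k < n → f k ≡ 0ℤ) → ∑< n f ≡ 0ℤ
∑-vanishes zero    f f≡0 = refl
∑-vanishes (suc n) f f≡0 =
  cong₂ _+_ (∑-vanishes n f (λ k k<n → f≡0 k (ℕP.m<n⇒m<1+n k<n))) (f≡0 n ℕP.≤-refl)

∑-shift : ∀ n f → ∑< (suc n) f ≡ f 0 + (∑[ k < n ] f (suc k))
∑-shift zero    f = ℤP.+-comm 0ℤ (f 0)
∑-shift (suc n) f = trans (cong (_+ f (suc n)) (∑-shift n f)) (ℤP.+-assoc (f 0) _ _)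

∑-shift-+ : ∀ n f g → f 0 ≡ 0ℤ → g n ≡ 0ℤ →
            ∑[ k < n ] (f (suc k) + g k) ≡ ∑[ k < suc n ] (f k + g k)
∑-shift-+ n f g f0≡0 gn≡0 = begin
    ∑[ k < n ] (f (suc k) + g k)
  ≡⟨ ∑-+ n (λ k → f (suc k)) g ⟩
    F + ∑< n g
  ≡⟨ pad F (∑< n g) ⟩
    (0ℤ + F) + (∑< n g + 0ℤ)
  ≡⟨ cong₂ (λ a b → (a + F) + (∑< n g + b)) (sym f0≡0) (sym gn≡0) ⟩
    (f 0 + F) + ∑< (suc n) g
  ≡⟨ cong (_+ ∑< (suc n) g) (sym (∑-shift n f)) ⟩
    ∑< (suc n) f + ∑< (suc n) g
  ≡⟨ sym (∑-+ (suc n) f g) ⟩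
    ∑[ k < suc n ] (f k + g k)
  ∎
  where
  F = ∑[ k < n ] f (suc k)
  pad : ∀ a b → a + b ≡ (+ 0 + a) + (b + + 0)
  pad = solve-∀

-- The functions B l and their products

B : ℕ → ℕ → ℤ
B l k = binom k l * binom (l ℕ.+ k) l

pronic : ℕ → ℤ
pronic k = + k * + suc k

B-recurrence : ∀ j k → + suc j * + suc j * B (suc j) k ≡ (pronic k - pronic j) * B j k
B-recurrence j k = begin
    + suc j * + suc j * (u * v)
  ≡⟨ regroup (+ j) u v x ⟩
    (+ suc j * u + + j * x - + j * x) * (+ suc j * v)
  ≡⟨ cong₂ (λ a b → (a - + j * x) * b) (binom-row-step k j) (binom-absorption (j ℕ.+ k) j) ⟩
    (+ k * x - + j * x) * (+ suc (j ℕ.+ k) * y)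
  ≡⟨ factor (+ j) (+ k) x y ⟩
    (pronic k - pronic j) * (x * y)
  ∎
  where
  x = binom k j
  y = binom (j ℕ.+ k) j
  u = binom k (suc j)
  v = binom (suc (j ℕ.+ k)) (suc j)
  regroup : ∀ j u v x → (+ 1 + j) * (+ 1 + j) * (u * v) ≡ ((+ 1 + j) * u + j * x - j * x) * ((+ 1 + j) * v)
  regroup = solve-∀
  factor : ∀ j k x y → (k * x - j * x) * ((+ 1 + j + k) * y) ≡ (k * (+ 1 + k) - j * (+ 1 + j)) * (x * y)
  factor = solve-∀

pronic-*-B : ∀ j k l →
  (pronic k - pronic j) * B l k ≡ + suc l * + suc l * B (suc l) k + (pronic l - pronic j) * B l k
pronic-*-B j k l = begin
    (pronic k - pronic j) * B l k
  ≡⟨ split (pronic k) (pronic j) (pronic l) (B l k) ⟩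
    (pronic k - pronic l) * B l k + (pronic l - pronic j) * B l k
  ≡⟨ cong (_+ (pronic l - pronic j) * B l k) (sym (B-recurrence l k)) ⟩
    + suc l * + suc l * B (suc l) k + (pronic l - pronic j) * B l k
  ∎
  where
  split : ∀ tk tj tl b → (tk - tj) * b ≡ (tk - tl) * b + (tl - tj) * b
  split = solve-∀

linCoeff : ℕ → ℕ → ℕ → ℤ
linCoeff i j l = binom l i * binom l j * binom (i ℕ.+ j) l

-- At l = 0 the truncated l ∸ 1 is harmless, since the factor l² vanishes.
linCoeff-recurrence : ∀ i j l →
  + suc j * + suc j * linCoeff i (suc j) l ≡
  + l * + l * linCoeff i j (l ∸ 1) + (pronic l - pronic j) * linCoeff i j l
linCoeff-recurrence i zero    zero    = vanish (+ 1) (binom 0 i) (binom (suc i) 0)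
  where
  vanish : ∀ s a c → s * s * (a * + 0 * c) ≡ + 0
  vanish = solve-∀
linCoeff-recurrence i (suc j) zero    =
  vanish (+ suc (suc j)) (binom 0 i) (binom (i ℕ.+ suc (suc j)) 0) (pronic (suc j))
  where
  vanish : ∀ s a c p → s * s * (a * + 0 * c) ≡ + 0 + (+ 0 - p) * (a * + 0 * c)
  vanish = solve-∀
linCoeff-recurrence i j (suc m) = begin
    + suc j * + suc j * (X * W * binom (i ℕ.+ suc j) (suc m))
  ≡⟨ cong (λ N → + suc j * + suc j * (X * W * binom N (suc m))) (ℕP.+-suc i j) ⟩
    + suc j * + suc j * (X * W * binom (suc (i ℕ.+ j)) (suc m))
  ≡⟨ cong (λ z → + suc j * + suc j * (X * W * z)) (sym (binom-pascal (i ℕ.+ j) m)) ⟩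
    + suc j * + suc j * (X * W * (Z′ + Z))
  ≡⟨ certificate (+ i) (+ j) (+ m) X Y Z Z′ W P Q ⟩
    RHS + μ₁ * δ₁ - μ₂ * δ₂ - μ₃ * δ₃ - μ₄ * δ₄
  ≡⟨ cong₂ (λ a b → RHS + μ₁ * a - μ₂ * b - μ₃ * δ₃ - μ₄ * δ₄) δ₁≡0 δ₂≡0 ⟩
    RHS + μ₁ * 0ℤ - μ₂ * 0ℤ - μ₃ * δ₃ - μ₄ * δ₄
  ≡⟨ cong₂ (λ a b → RHS + μ₁ * 0ℤ - μ₂ * 0ℤ - μ₃ * a - μ₄ * b) δ₃≡0 δ₄≡0 ⟩
    RHS + μ₁ * 0ℤ - μ₂ * 0ℤ - μ₃ * 0ℤ - μ₄ * 0ℤ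
  ≡⟨ drop RHS μ₁ μ₂ μ₃ μ₄ ⟩
    RHS
  ∎
  where
  X = binom (suc m) i
  Y = binom (suc m) j
  W = binom (suc m) (suc j)
  Z = binom (i ℕ.+ j) (suc m)
  Z′ = binom (i ℕ.+ j) m
  P = binom m i
  Q = binom m j
  RHS = + suc m * + suc m * linCoeff i j m + (pronic (suc m) - pronic j) * linCoeff i j (suc m)
  δ₁ = + suc j * W + + j * Y - + suc m * Y
  δ₂ = + suc m * P + + i * X - + suc m * X
  δ₃ = + suc m * Q + + j * Y - + suc m * Y
  δ₄ = + suc m * Z + + m * Z′ - + (i ℕ.+ j) * Z′
  δ₁≡0 : δ₁ ≡ 0ℤ
  δ₁≡0 = ℤP.i≡j⇒i-j≡0 (binom-row-step (suc m) j)
  δ₂≡0 : δ₂ ≡ 0ℤ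
  δ₂≡0 = ℤP.i≡j⇒i-j≡0 (binom-column-step m i)
  δ₃≡0 : δ₃ ≡ 0ℤ
  δ₃≡0 = ℤP.i≡j⇒i-j≡0 (binom-column-step m j)
  δ₄≡0 : δ₄ ≡ 0ℤ
  δ₄≡0 = ℤP.i≡j⇒i-j≡0 (binom-row-step (i ℕ.+ j) m)
  μ₁ = + suc j * X * (Z′ + Z)
  μ₂ = Z′ * + suc m * Q
  μ₃ = Z′ * (+ suc m - + i) * X
  μ₄ = (+ suc m - + j) * X * Y
  -- LHS − RHS as a combination of the δᵢ: a ring identity in the binomial atoms.
  certificate : ∀ I J M X Y Z Z′ W P Q →
    (+ 1 + J) * (+ 1 + J) * (X * W * (Z′ + Z)) ≡
    ((+ 1 + M) * (+ 1 + M) * (P * Q * Z′) + ((+ 1 + M) * (+ 1 + (+ 1 + M)) - J * (+ 1 + J)) * (X * Y * Z))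
      + ((+ 1 + J) * X * (Z′ + Z)) * ((+ 1 + J) * W + J * Y - (+ 1 + M) * Y)
      - (Z′ * (+ 1 + M) * Q) * ((+ 1 + M) * P + I * X - (+ 1 + M) * X)
      - (Z′ * ((+ 1 + M) - I) * X) * ((+ 1 + M) * Q + J * Y - (+ 1 + M) * Y)
      - (((+ 1 + M) - J) * X * Y) * ((+ 1 + M) * Z + M * Z′ - (I + J) * Z′)
  certificate = solve-∀
  drop : ∀ r a b c d → r + a * + 0 - b * + 0 - c * + 0 - d * + 0 ≡ r
  drop = solve-∀

B-product : ∀ i j k → B i k * B j k ≡ ∑[ l < suc (i ℕ.+ j) ] linCoeff i j l * B l k
B-product i zero k = begin
    B i k * 1ℤ
  ≡⟨ ℤP.*-identityʳ (B i k) ⟩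
    B i k
  ≡⟨ sym (ℤP.+-identityˡ (B i k)) ⟩
    0ℤ + B i k
  ≡⟨ cong₂ _+_ (sym (∑-vanishes i term below-diagonal)) (sym diagonal) ⟩
    ∑< (suc i) term
  ≡⟨ cong (λ N → ∑< (suc N) term) (sym (ℕP.+-identityʳ i)) ⟩
    ∑< (suc (i ℕ.+ 0)) term
  ∎
  where
  term : ℕ → ℤ
  term l = linCoeff i 0 l * B l k
  below-diagonal : ∀ l → l < i → term l ≡ 0ℤ
  below-diagonal l l<i = cong (λ c → c * binom l 0 * binom (i ℕ.+ 0) l * B l k) (binom-vanishes l<i)
  diagonal : term i ≡ B i k
  diagonal = begin
      binom i i * 1ℤ * binom (i ℕ.+ 0) i * B i k
    ≡⟨ cong₂ (λ a b → a * 1ℤ * b * B i k) (binom-diagonal i)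
             (trans (cong (λ N → binom N i) (ℕP.+-identityʳ i)) (binom-diagonal i)) ⟩
      1ℤ * 1ℤ * 1ℤ * B i k
    ≡⟨ ℤP.*-identityˡ (B i k) ⟩
      B i k
    ∎
B-product i (suc j) k = ℤP.*-cancelˡ-≡ (+ suc j * + suc j) _ _ (begin
    + suc j * + suc j * (B i k * B (suc j) k)
  ≡⟨ swap (+ suc j * + suc j) (B i k) (B (suc j) k) ⟩
    B i k * (+ suc j * + suc j * B (suc j) k)
  ≡⟨ cong (B i k *_) (B-recurrence j k) ⟩
    B i k * ((pronic k - pronic j) * B j k)
  ≡⟨ swap (B i k) (pronic k - pronic j) (B j k) ⟩
    (pronic k - pronic j) * (B i k * B j k)
  ≡⟨ cong ((pronic k - pronic j) *_) (B-product i j k) ⟩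
    (pronic k - pronic j) * (∑[ l < L ] linCoeff i j l * B l k)
  ≡⟨ sym (∑-*ˡ L (pronic k - pronic j) (λ l → linCoeff i j l * B l k)) ⟩
    ∑[ l < L ] (pronic k - pronic j) * (linCoeff i j l * B l k)
  ≡⟨ ∑-cong L raise ⟩
    ∑[ l < L ] (lower (suc l) + same l)
  ≡⟨ ∑-shift-+ L lower same refl same-L≡0 ⟩
    ∑[ l < suc L ] (lower l + same l)
  ≡⟨ ∑-cong (suc L) recombine ⟩
    ∑[ l < suc L ] + suc j * + suc j * (linCoeff i (suc j) l * B l k)
  ≡⟨ ∑-*ˡ (suc L) (+ suc j * + suc j) (λ l → linCoeff i (suc j) l * B l k) ⟩
    + suc j * + suc j * (∑[ l < suc L ] linCoeff i (suc j) l * B l k)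
  ≡⟨ cong (λ N → + suc j * + suc j * (∑[ l < suc N ] linCoeff i (suc j) l * B l k))
          (sym (ℕP.+-suc i j)) ⟩
    + suc j * + suc j * (∑[ l < suc (i ℕ.+ suc j) ] linCoeff i (suc j) l * B l k)
  ∎)
  where
  swap : ∀ a b c → a * (b * c) ≡ b * (a * c)
  swap = solve-∀
  L = suc (i ℕ.+ j)
  lower same : ℕ → ℤ
  lower l = + l * + l * linCoeff i j (l ∸ 1) * B l k
  same  l = (pronic l - pronic j) * linCoeff i j l * B l k
  raise : ∀ l → (pronic k - pronic j) * (linCoeff i j l * B l k) ≡ lower (suc l) + same l
  raise l = begin
      (pronic k - pronic j) * (linCoeff i j l * B l k)
    ≡⟨ swap (pronic k - pronic j) (linCoeff i j l) (B l k) ⟩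
      linCoeff i j l * ((pronic k - pronic j) * B l k)
    ≡⟨ cong (linCoeff i j l *_) (pronic-*-B j k l) ⟩
      linCoeff i j l * (+ suc l * + suc l * B (suc l) k + (pronic l - pronic j) * B l k)
    ≡⟨ distribute (linCoeff i j l) (+ suc l) (B (suc l) k) (pronic l - pronic j) (B l k) ⟩
      lower (suc l) + same l
    ∎
    where
    distribute : ∀ c s b′ d b → c * (s * s * b′ + d * b) ≡ s * s * c * b′ + d * c * b
    distribute = solve-∀
  same-L≡0 : same L ≡ 0ℤ
  same-L≡0 = trans (cong (λ z → (pronic L - pronic j) * (binom L i * binom L j * z) * B L k)
                         (binom-vanishes (ℕP.n<1+n (i ℕ.+ j))))
                   (vanish (pronic L - pronic j) (binom L i * binom L j) (B L k))
    where
    vanish : ∀ a b c → a * (b * + 0) * c ≡ + 0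
    vanish = solve-∀
  recombine : ∀ l → lower l + same l ≡ + suc j * + suc j * (linCoeff i (suc j) l * B l k)
  recombine l = begin
      lower l + same l
    ≡⟨ factor (+ l * + l * linCoeff i j (l ∸ 1)) (pronic l - pronic j) (linCoeff i j l) (B l k) ⟩
      (+ l * + l * linCoeff i j (l ∸ 1) + (pronic l - pronic j) * linCoeff i j l) * B l k
    ≡⟨ cong (_* B l k) (sym (linCoeff-recurrence i j l)) ⟩
      + suc j * + suc j * linCoeff i (suc j) l * B l k
    ≡⟨ ℤP.*-assoc (+ suc j * + suc j) (linCoeff i (suc j) l) (B l k) ⟩
      + suc j * + suc j * (linCoeff i (suc j) l * B l k)
    ∎
    where
    factor : ∀ a d c b → a * b + d * c * b ≡ (a + d * c) * b
    factor = solve-∀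

data Span : (ℕ → ℤ) → Set where
  basis : ∀ l → Span (B l)
  plus  : ∀ {f g} → Span f → Span g → Span (λ k → f k + g k)
  scale : ∀ {f} c → Span f → Span (λ k → c * f k)
  resp  : ∀ {f g} → f ≗ g → Span f → Span g

Span-0 : Span (λ _ → 0ℤ)
Span-0 = scale 0ℤ (basis 0)

Span-1 : Span (λ _ → 1ℤ)
Span-1 = basis 0

Span-pronic : Span pronic
Span-pronic = resp (λ k → cong₂ (λ a b → + a * + b) (nC1≡n k) (nC1≡n (suc k))) (basis 1)

Span-∑ : ∀ L (c : ℕ → ℤ) → Span (λ k → ∑[ l < L ] c l * B l k)
Span-∑ zero    c = Span-0
Span-∑ (suc L) c = plus (Span-∑ L c) (scale (c L) (basis L))

Span-B* : ∀ i {g} → Span g → Span (λ k → B i k * g k)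
Span-B* i (basis j)         = resp (λ k → sym (B-product i j k)) (Span-∑ (suc (i ℕ.+ j)) (linCoeff i j))
Span-B* i (plus {f} {g} p q) =
  resp (λ k → sym (ℤP.*-distribˡ-+ (B i k) (f k) (g k))) (plus (Span-B* i p) (Span-B* i q))
Span-B* i (scale {f} c p)   = resp (λ k → swap c (B i k) (f k)) (scale c (Span-B* i p))
  where
  swap : ∀ a b c → a * (b * c) ≡ b * (a * c)
  swap = solve-∀
Span-B* i (resp f≗g p)      = resp (λ k → cong (B i k *_) (f≗g k)) (Span-B* i p)

Span-* : ∀ {f g} → Span f → Span g → Span (λ k → f k * g k)
Span-* (basis i)                q = Span-B* i q
Span-* {g = h} (plus {f} {g} p p′) q =
  resp (λ k → sym (ℤP.*-distribʳ-+ (h k) (f k) (g k))) (plus (Span-* p q) (Span-* p′ q))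
Span-* {g = h} (scale {f} c p)     q = resp (λ k → sym (ℤP.*-assoc c (f k) (h k))) (scale c (Span-* p q))
Span-* {g = h} (resp f≗g p)        q = resp (λ k → cong (_* h k) (f≗g k)) (Span-* p q)

Span-^ : ∀ {f} → Span f → ∀ n → Span (λ k → f k ^ n)
Span-^ p zero    = Span-1
Span-^ p (suc n) = Span-* p (Span-^ p n)

-- Divisibility of the sums Φ

weight : ℤ → ℕ → ℤ
weight ε k = ε ^ k * (+ 2 * + k + + 1)

Φ : ℤ → ℕ → (ℕ → ℤ) → ℤ
Φ ε n f = ∑[ k < n ] weight ε k * f k

Φ-B-plus : ∀ l n → Φ 1ℤ n (B l) ≡ + n * (binom (l ℕ.+ n) l * binom n (suc l))
Φ-B-plus l zero    = refl
Φ-B-plus l (suc n) = begin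
    Φ 1ℤ n (B l) + 1ℤ ^ n * w * (x * Q)
  ≡⟨ cong₂ (λ a b → a + b * w * (x * Q)) (Φ-B-plus l n) (ℤP.^-zeroˡ n) ⟩
    + n * (Q * y) + 1ℤ * w * (x * Q)
  ≡⟨ certificate (+ n) (+ l) x y Q Q′ ⟩
    + suc n * (Q′ * (x + y)) - (x + y) * δ₁ - Q * δ₂
  ≡⟨ cong₂ (λ a b → + suc n * (Q′ * (x + y)) - (x + y) * a - Q * b) δ₁≡0 δ₂≡0 ⟩
    + suc n * (Q′ * (x + y)) - (x + y) * 0ℤ - Q * 0ℤ
  ≡⟨ drop (+ suc n * (Q′ * (x + y))) (x + y) Q ⟩
    + suc n * (Q′ * (x + y))
  ≡⟨ cong (λ z → + suc n * (Q′ * z)) (binom-pascal n l) ⟩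
    + suc n * (Q′ * binom (suc n) (suc l))
  ∎
  where
  w = + 2 * + n + + 1
  x = binom n l
  y = binom n (suc l)
  Q = binom (l ℕ.+ n) l
  Q′ = binom (l ℕ.+ suc n) l
  δ₁ = + suc n * Q′ - + suc (l ℕ.+ n) * Q
  δ₂ = + suc l * y + + l * x - + n * x
  δ₁≡0 : δ₁ ≡ 0ℤ
  δ₁≡0 = ℤP.i≡j⇒i-j≡0 (binom-column-step′ l n)
  δ₂≡0 : δ₂ ≡ 0ℤ
  δ₂≡0 = ℤP.i≡j⇒i-j≡0 (binom-row-step n l)
  certificate : ∀ N L x y Q Q′ →
    N * (Q * y) + + 1 * (+ 2 * N + + 1) * (x * Q) ≡
    (+ 1 + N) * (Q′ * (x + y)) - (x + y) * ((+ 1 + N) * Q′ - (+ 1 + L + N) * Q)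
      - Q * ((+ 1 + L) * y + L * x - N * x)
  certificate = solve-∀
  drop : ∀ r a b → r - a * + 0 - b * + 0 ≡ r
  drop = solve-∀

Φ-B-minus : ∀ l n → Φ -1ℤ (suc n) (B l) ≡ -1ℤ ^ n * (+ suc n * (binom (l ℕ.+ suc n) l * binom n l))
Φ-B-minus zero    zero    = refl
Φ-B-minus (suc l) zero    = vanish (binom (suc l ℕ.+ 1) (suc l))
  where
  vanish : ∀ y → + 0 ≡ + 1 * (+ 1 * (y * + 0))
  vanish = solve-∀
Φ-B-minus l (suc n) = begin
    Φ -1ℤ (suc n) (B l) + -1ℤ * s * w * (X * Q)
  ≡⟨ cong (_+ -1ℤ * s * w * (X * Q)) (Φ-B-minus l n) ⟩
    s * (+ suc n * (Q * x)) + -1ℤ * s * w * (X * Q)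
  ≡⟨ certificate s (+ suc n) (+ l) x X Q Q″ ⟩
    RHS + s * X * δ₁ + s * Q * δ₂
  ≡⟨ cong₂ (λ a b → RHS + s * X * a + s * Q * b) δ₁≡0 δ₂≡0 ⟩
    RHS + s * X * 0ℤ + s * Q * 0ℤ
  ≡⟨ drop RHS (s * X) (s * Q) ⟩
    RHS
  ∎
  where
  s = -1ℤ ^ n
  w = + 2 * + suc n + + 1
  x = binom n l
  X = binom (suc n) l
  Q = binom (l ℕ.+ suc n) l
  Q″ = binom (l ℕ.+ suc (suc n)) l
  RHS = -1ℤ * s * (+ suc (suc n) * (Q″ * X))
  δ₁ = + suc (suc n) * Q″ - + suc (l ℕ.+ suc n) * Q
  δ₂ = + suc n * x + + l * X - + suc n * X
  δ₁≡0 : δ₁ ≡ 0ℤ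
  δ₁≡0 = ℤP.i≡j⇒i-j≡0 (binom-column-step′ l (suc n))
  δ₂≡0 : δ₂ ≡ 0ℤ
  δ₂≡0 = ℤP.i≡j⇒i-j≡0 (binom-column-step n l)
  certificate : ∀ s N L x X Q Q″ →
    s * (N * (Q * x)) + - + 1 * s * (+ 2 * N + + 1) * (X * Q) ≡
    - + 1 * s * ((+ 1 + N) * (Q″ * X)) + s * X * ((+ 1 + N) * Q″ - (+ 1 + L + N) * Q)
      + s * Q * (N * x + L * X - N * X)
  certificate = solve-∀
  drop : ∀ r a b → r + a * + 0 + b * + 0 ≡ r
  drop = solve-∀

n∣Φ-B : ∀ {ε} → ε ≡ 1ℤ ⊎ ε ≡ -1ℤ → ∀ l n → + n ∣ₛ Φ ε n (B l)
n∣Φ-B (inj₁ refl) l n =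
  subst (+ n ∣ₛ_) (sym (Φ-B-plus l n)) (∣m⇒∣m*n _ ∣-refl)
n∣Φ-B (inj₂ refl) l zero    = Signed.divides 0ℤ refl
n∣Φ-B (inj₂ refl) l (suc n) =
  subst (+ suc n ∣ₛ_) (sym (Φ-B-minus l n)) (∣n⇒∣m*n (-1ℤ ^ n) (∣m⇒∣m*n _ ∣-refl))

Φ-cong : ∀ ε n {f g} → f ≗ g → Φ ε n f ≡ Φ ε n g
Φ-cong ε n f≗g = ∑-cong n (λ k → cong (weight ε k *_) (f≗g k))

Φ-+ : ∀ ε n f g → Φ ε n (λ k → f k + g k) ≡ Φ ε n f + Φ ε n g
Φ-+ ε n f g = trans (∑-cong n (λ k → ℤP.*-distribˡ-+ (weight ε k) (f k) (g k))) (∑-+ n _ _)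

Φ-*ˡ : ∀ ε n c f → Φ ε n (λ k → c * f k) ≡ c * Φ ε n f
Φ-*ˡ ε n c f = trans (∑-cong n (λ k → swap (weight ε k) c (f k))) (∑-*ˡ n c _)
  where
  swap : ∀ a b c → a * (b * c) ≡ b * (a * c)
  swap = solve-∀

n∣Φ : ∀ {ε f} → ε ≡ 1ℤ ⊎ ε ≡ -1ℤ → Span f → ∀ n → + n ∣ₛ Φ ε n f
n∣Φ unit (basis l)          n = n∣Φ-B unit l n
n∣Φ {ε} unit (plus {f} {g} p q) n =
  subst (+ n ∣ₛ_) (sym (Φ-+ ε n f g)) (∣m∣n⇒∣m+n (n∣Φ unit p n) (n∣Φ unit q n))
n∣Φ {ε} unit (scale {f} c p)    n =
  subst (+ n ∣ₛ_) (sym (Φ-*ˡ ε n c f)) (∣n⇒∣m*n c (n∣Φ unit p n))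
n∣Φ {ε} unit (resp f≗g p)       n = subst (+ n ∣ₛ_) (Φ-cong ε n f≗g) (n∣Φ unit p n)

consecutive-∣Φ : ∀ {ε f} → ε ≡ 1ℤ ⊎ ε ≡ -1ℤ → Span f → (∀ k → pronic k ∣ₛ f k) → ∀ n →
  + n ∣ₛ Φ ε (suc n) f × + suc n ∣ₛ Φ ε (suc n) f × + suc (suc n) ∣ₛ Φ ε (suc n) f
consecutive-∣Φ {ε} {f} unit span pronic∣f n =
    ∣m∣n⇒∣m+n (n∣Φ unit span n) (∣n⇒∣m*n (weight ε n) (∣-trans k∣pronic (pronic∣f n)))
  , n∣Φ unit span (suc n)
  , ∣m+n∣n⇒∣m (n∣Φ unit span (suc (suc n)))
      (∣n⇒∣m*n (weight ε (suc n)) (∣-trans (∣n⇒∣m*n (+ suc n) ∣-refl) (pronic∣f (suc n))))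
  where
  k∣pronic : + n ∣ₛ pronic n
  k∣pronic = ∣m⇒∣m*n (+ suc n) ∣-refl

coeff-⊕ : ∀ p q i → coeff (p ⊕ q) i ≡ coeff p i + coeff q i
coeff-⊕ []      q       i       = sym (ℤP.+-identityˡ (coeff q i))
coeff-⊕ (c ∷ p) []      i       = sym (ℤP.+-identityʳ (coeff (c ∷ p) i))
coeff-⊕ (c ∷ p) (d ∷ q) zero    = refl
coeff-⊕ (c ∷ p) (d ∷ q) (suc i) = coeff-⊕ p q i

coeff-· : ∀ c p i → coeff (c · p) i ≡ c * coeff p i
coeff-· c []      i       = sym (ℤP.*-zeroʳ c)
coeff-· c (d ∷ p) zero    = refl
coeff-· c (d ∷ p) (suc i) = coeff-· c p i

conv : (ℕ → ℤ) → (ℕ → ℤ) → ℕ → ℤ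
conv f g zero    = f 0 * g 0
conv f g (suc i) = f 0 * g (suc i) + conv (λ j → f (suc j)) g i

conv-zeroˡ : ∀ g i → conv (λ _ → 0ℤ) g i ≡ 0ℤ
conv-zeroˡ g zero    = refl
conv-zeroˡ g (suc i) = trans (ℤP.+-identityˡ _) (conv-zeroˡ g i)

coeff-⊗ : ∀ p q i → coeff (p ⊗ q) i ≡ conv (coeff p) (coeff q) i
coeff-⊗ []      q i       = sym (conv-zeroˡ (coeff q) i)
coeff-⊗ (c ∷ p) q zero    =
  trans (coeff-⊕ (c · q) (0ℤ ∷ (p ⊗ q)) 0) (trans (ℤP.+-identityʳ _) (coeff-· c q 0))
coeff-⊗ (c ∷ p) q (suc i) =
  trans (coeff-⊕ (c · q) (0ℤ ∷ (p ⊗ q)) (suc i)) (cong₂ _+_ (coeff-· c q (suc i)) (coeff-⊗ p q i))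

coeff-map-applyUpTo-< : ∀ (g : ℕ → ℤ) f n j → j < n → coeff (map g (applyUpTo f n)) j ≡ g (f j)
coeff-map-applyUpTo-< g f (suc n) zero    _         = refl
coeff-map-applyUpTo-< g f (suc n) (suc j) (s≤s j<n) = coeff-map-applyUpTo-< g (λ x → f (suc x)) n j j<n

coeff-map-applyUpTo-≥ : ∀ (g : ℕ → ℤ) f n j → n ≤ j → coeff (map g (applyUpTo f n)) j ≡ 0ℤ
coeff-map-applyUpTo-≥ g f zero    j       _         = refl
coeff-map-applyUpTo-≥ g f (suc n) (suc j) (s≤s n≤j) = coeff-map-applyUpTo-≥ g (λ x → f (suc x)) n j n≤j

pos-^ : ∀ a n → + (a ℕ.^ n) ≡ (+ a) ^ n
pos-^ a zero    = refl
pos-^ a (suc n) = trans (ℤP.pos-* a (a ℕ.^ n)) (cong (+ a *_) (pos-^ a n))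

^-distribʳ-* : ∀ x y n → (x * y) ^ n ≡ x ^ n * y ^ n
^-distribʳ-* x y zero    = refl
^-distribʳ-* x y (suc n) = trans (cong (x * y *_) (^-distribʳ-* x y n)) (interchange x y (x ^ n) (y ^ n))
  where
  interchange : ∀ x y a b → x * y * (a * b) ≡ x * a * (y * b)
  interchange = solve-∀

pos-^-* : ∀ a b n → + (a ℕ.^ n ℕ.* b ℕ.^ n) ≡ (+ a * + b) ^ n
pos-^-* a b n =
  trans (ℤP.pos-* (a ℕ.^ n) (b ℕ.^ n))
        (trans (cong₂ _*_ (pos-^ a n) (pos-^ b n)) (sym (^-distribʳ-* (+ a) (+ b) n)))

-- h ≥ 1 matters here: for h = 0 the coefficient of x^j would be 1 for j ≤ k and 0 beyond.
coeff-D : ∀ h k j → coeff (D (suc h) k) j ≡ B j k ^ suc h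
coeff-D h k j with j ℕ.<? suc k
... | yes j<1+k = begin
    coeff (D (suc h) k) j
  ≡⟨ coeff-map-applyUpTo-< _ id (suc k) j j<1+k ⟩
    + ((k C j) ℕ.^ suc h ℕ.* ((k ℕ.+ j) C j) ℕ.^ suc h)
  ≡⟨ pos-^-* (k C j) ((k ℕ.+ j) C j) (suc h) ⟩
    (binom k j * binom (k ℕ.+ j) j) ^ suc h
  ≡⟨ cong (λ N → (binom k j * binom N j) ^ suc h) (ℕP.+-comm k j) ⟩
    B j k ^ suc h
  ∎
... | no  j≮1+k = begin
    coeff (D (suc h) k) j
  ≡⟨ coeff-map-applyUpTo-≥ _ id (suc k) j (ℕP.≮⇒≥ j≮1+k) ⟩
    0ℤ
  ≡⟨ cong (_^ suc h) (sym (ℤP.*-zeroˡ (binom (j ℕ.+ k) j))) ⟩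
    (0ℤ * binom (j ℕ.+ k) j) ^ suc h
  ≡⟨ cong (λ c → (c * binom (j ℕ.+ k) j) ^ suc h)
          (sym (binom-vanishes (ℕP.≤-trans (ℕP.n<1+n k) (ℕP.≮⇒≥ j≮1+k)))) ⟩
    B j k ^ suc h
  ∎

SpanCoeffs : (ℕ → Poly) → Set
SpanCoeffs P = ∀ i → Span (λ k → coeff (P k) i)

Span-conv : ∀ (F G : ℕ → ℕ → ℤ) → (∀ j → Span (λ k → F k j)) → (∀ j → Span (λ k → G k j)) →
            ∀ i → Span (λ k → conv (F k) (G k) i)
Span-conv F G hF hG zero    = Span-* (hF 0) (hG 0)
Span-conv F G hF hG (suc i) =
  plus (Span-* (hF 0) (hG (suc i))) (Span-conv (λ k j → F k (suc j)) G (λ j → hF (suc j)) hG i)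

SpanCoeffs-⊗ : ∀ {P Q} → SpanCoeffs P → SpanCoeffs Q → SpanCoeffs (λ k → P k ⊗ Q k)
SpanCoeffs-⊗ {P} {Q} hP hQ i =
  resp (λ k → sym (coeff-⊗ (P k) (Q k) i)) (Span-conv (λ k → coeff (P k)) (λ k → coeff (Q k)) hP hQ i)

SpanCoeffs-^ : ∀ {P} → SpanCoeffs P → ∀ m → SpanCoeffs (λ k → P k ^ᵖ m)
SpanCoeffs-^ hP zero    zero    = Span-1
SpanCoeffs-^ hP zero    (suc i) = Span-0
SpanCoeffs-^ {P} hP (suc m)     = SpanCoeffs-⊗ {P} {λ k → P k ^ᵖ m} hP (SpanCoeffs-^ hP m)

SpanCoeffs-D : ∀ h → SpanCoeffs (D (suc h))
SpanCoeffs-D h j = resp (λ k → sym (coeff-D h k j)) (Span-^ (basis j) (suc h))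

coeff-sumFrom1 : ∀ n f i → coeff (sumFrom1 n f) i ≡ ∑[ k < n ] coeff (f (suc k)) i
coeff-sumFrom1 zero    f i = refl
coeff-sumFrom1 (suc n) f i =
  trans (coeff-⊕ (sumFrom1 n f) (f (suc n)) i) (cong (_+ coeff (f (suc n)) i) (coeff-sumFrom1 n f i))

coeff-summand : ∀ h m a ε k i →
  coeff (summand h m a ε k) i ≡ weight ε k * (pronic k ^ a * coeff (D h k ^ᵖ m) i)
coeff-summand h m a ε k i = begin
    coeff (summand h m a ε k) i
  ≡⟨ coeff-· (ε ^ k * + (k ℕ.^ a ℕ.* suc k ℕ.^ a ℕ.* (2 ℕ.* k ℕ.+ 1))) (D h k ^ᵖ m) i ⟩
    ε ^ k * + (k ℕ.^ a ℕ.* suc k ℕ.^ a ℕ.* (2 ℕ.* k ℕ.+ 1)) * P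
  ≡⟨ cong (λ c → ε ^ k * c * P) (ℤP.pos-* (k ℕ.^ a ℕ.* suc k ℕ.^ a) (2 ℕ.* k ℕ.+ 1)) ⟩
    ε ^ k * (+ (k ℕ.^ a ℕ.* suc k ℕ.^ a) * + (2 ℕ.* k ℕ.+ 1)) * P
  ≡⟨ cong₂ (λ c d → ε ^ k * (c * d) * P) (pos-^-* k (suc k) a)
           (trans (ℤP.pos-+ (2 ℕ.* k) 1) (cong (_+ + 1) (ℤP.pos-* 2 k))) ⟩
    ε ^ k * (pronic k ^ a * (+ 2 * + k + + 1)) * P
  ≡⟨ regroup (ε ^ k) (pronic k ^ a) (+ 2 * + k + + 1) P ⟩
    weight ε k * (pronic k ^ a * P)
  ∎
  where
  P = coeff (D h k ^ᵖ m) i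
  regroup : ∀ e t w p → e * (t * w) * p ≡ e * w * (t * p)
  regroup = solve-∀

-- Φ has an extra k = 0 term, which vanishes since pronic 0 = 0.
coeff-S : ∀ h m n a ε i →
  coeff (S h m n (suc a) ε) i ≡ Φ ε (suc n) (λ k → pronic k ^ suc a * coeff (D h k ^ᵖ m) i)
coeff-S h m n a ε i = begin
    coeff (S h m n (suc a) ε) i
  ≡⟨ coeff-sumFrom1 n (summand h m (suc a) ε) i ⟩
    ∑[ k < n ] coeff (summand h m (suc a) ε (suc k)) i
  ≡⟨ ∑-cong n (λ k → coeff-summand h m (suc a) ε (suc k) i) ⟩
    ∑[ k < n ] term (suc k)
  ≡⟨ sym (ℤP.+-identityˡ _) ⟩
    term 0 + (∑[ k < n ] term (suc k))
  ≡⟨ sym (∑-shift n term) ⟩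
    ∑< (suc n) term
  ∎
  where
  term : ℕ → ℤ
  term k = weight ε k * (pronic k ^ suc a * coeff (D h k ^ᵖ m) i)

-- Numbers divisible by n, n + 1 and n + 2

*∣gcd* : ∀ {a b t} → a ∣ℕ t → b ∣ℕ t → a ℕ.* b ∣ℕ gcd a b ℕ.* t
*∣gcd* {a} {b} {t} a∣t b∣t =
  subst (_∣ℕ gcd a b ℕ.* t) (gcd*lcm a b) (ℕ∣.*-monoʳ-∣ (gcd a b) (lcm-least a∣t b∣t))

gcd[n,1+n]≡1 : ∀ n → gcd n (suc n) ≡ 1
gcd[n,1+n]≡1 n = ℕ∣.∣1⇒≡1 (ℕ∣.∣m+n∣m⇒∣n d∣n+1 (gcd[m,n]∣m n (suc n)))
  where
  d∣n+1 : gcd n (suc n) ∣ℕ n ℕ.+ 1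
  d∣n+1 = subst (gcd n (suc n) ∣ℕ_) (ℕP.+-comm 1 n) (gcd[m,n]∣n n (suc n))

gcd[n[1+n],2+n]∣gcd[2,n] : ∀ n → gcd (n ℕ.* suc n) (2 ℕ.+ n) ∣ℕ gcd 2 n
gcd[n[1+n],2+n]∣gcd[2,n] n = gcd-greatest d∣2 (ℕ∣.∣m+n∣m⇒∣n d∣2+n d∣2)
  where
  d = gcd (n ℕ.* suc n) (2 ℕ.+ n)
  d∣2+n : d ∣ℕ 2 ℕ.+ n
  d∣2+n = gcd[m,n]∣n (n ℕ.* suc n) (2 ℕ.+ n)
  d∣2[1+n] : d ∣ℕ 2 ℕ.* (1 ℕ.+ n)
  d∣2[1+n] = ℕ∣.∣m+n∣m⇒∣n (subst (d ∣ℕ_) (expand n) (ℕ∣.∣m⇒∣m*n (1 ℕ.+ n) d∣2+n))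
                           (gcd[m,n]∣m (n ℕ.* suc n) (2 ℕ.+ n))
    where
    expand : ∀ n → (2 ℕ.+ n) ℕ.* (1 ℕ.+ n) ≡ n ℕ.* (1 ℕ.+ n) ℕ.+ 2 ℕ.* (1 ℕ.+ n)
    expand = ℕSolver.solve-∀
  d∣2 : d ∣ℕ 2
  d∣2 = ℕ∣.∣m+n∣m⇒∣n (subst (d ∣ℕ_) (expand n) (ℕ∣.∣n⇒∣m*n 2 d∣2+n)) d∣2[1+n]
    where
    expand : ∀ n → 2 ℕ.* (2 ℕ.+ n) ≡ 2 ℕ.* (1 ℕ.+ n) ℕ.+ 2
    expand = ℕSolver.solve-∀

consecutive-∣ : ∀ {n t} → n ∣ℕ t → suc n ∣ℕ t → suc (suc n) ∣ℕ t →
                n ℕ.* suc n ℕ.* suc (suc n) ∣ℕ gcd 2 n ℕ.* t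
consecutive-∣ {n} {t} n∣t 1+n∣t 2+n∣t =
  ℕ∣.∣-trans (*∣gcd* n[1+n]∣t 2+n∣t) (ℕ∣.*-monoˡ-∣ t (gcd[n[1+n],2+n]∣gcd[2,n] n))
  where
  n[1+n]∣t : n ℕ.* suc n ∣ℕ t
  n[1+n]∣t = subst (n ℕ.* suc n ∣ℕ_) (trans (cong (ℕ._* t) (gcd[n,1+n]≡1 n)) (ℕP.*-identityˡ t))
                   (*∣gcd* n∣t 1+n∣t)

theorem2p1 : (h m n a : ℕ) → 1 ≤ h → 1 ≤ m → 1 ≤ n → 1 ≤ a →
    (ε : ℤ) → (ε ≡ + 1 ⊎ ε ≡ - (+ 1)) →
    ∀ i → + (n ℕ.* (n ℕ.+ 1) ℕ.* (n ℕ.+ 2)) ∣ (+ gcd 2 n) ℤ.* coeff (S h m n a ε) i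
theorem2p1 zero    _ _ _       () _ _ _ _ _    _
theorem2p1 (suc h) _ _ zero    _  _ _ () _ _    _
theorem2p1 (suc h) m n (suc a) _  _ _ _  ε unit i =
  subst₂ _∣ℕ_ divisor (sym (ℤP.abs-* (+ gcd 2 n) T))
         (consecutive-∣ (∣T (proj₁ divisors)) (∣T (proj₁ (proj₂ divisors))) (∣T (proj₂ (proj₂ divisors))))
  where
  P f : ℕ → ℤ
  P k = coeff (D (suc h) k ^ᵖ m) i
  f k = pronic k ^ suc a * P k
  T : ℤ
  T = coeff (S (suc h) m n (suc a) ε) i
  span : Span f
  span = Span-* (Span-^ Span-pronic (suc a)) (SpanCoeffs-^ (SpanCoeffs-D h) m i)
  pronic∣f : ∀ k → pronic k ∣ₛ f k
  pronic∣f k = ∣m⇒∣m*n (P k) (∣m⇒∣m*n (pronic k ^ a) ∣-refl)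
  divisors : + n ∣ₛ Φ ε (suc n) f × + suc n ∣ₛ Φ ε (suc n) f × + suc (suc n) ∣ₛ Φ ε (suc n) f
  divisors = consecutive-∣Φ unit span pronic∣f n
  ∣T : ∀ {d} → + d ∣ₛ Φ ε (suc n) f → d ∣ℕ ℤ.∣ T ∣
  ∣T d∣Φ = ∣⇒∣ᵤ (subst (_ ∣ₛ_) (sym (coeff-S (suc h) m n a ε i)) d∣Φ)
  divisor : n ℕ.* suc n ℕ.* suc (suc n) ≡ n ℕ.* (n ℕ.+ 1) ℕ.* (n ℕ.+ 2)
  divisor = cong₂ (λ b c → n ℕ.* b ℕ.* c) (ℕP.+-comm 1 n) (ℕP.+-comm 2 n)
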